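{- For every integer $n\ge 3$, $d_4(n,n-2)=3$ if $n=3$, and $d_4(n,n-2)=2$ if $n\ge 4$.
   Context: Let $\mathbb{F}_4=\{0,1,\omega,\omega^2\}$ with $\omega^2=\omega+1$, and for $x\in\mathbb{F}_4$ let $\overline{x}=x^2$. An $[n,k]_4$ code is a $k$-dimensional subspace $C$ of $\mathbb{F}_4^n$. Its minimum weight is the smallest number of nonzero coordinates of a nonzero vector of $C$. The Hermitian dual is $C^{\perp_H}=\{x\in\mathbb{F}_4^n:\sum_i x_i\overline{y_i}=0\ \forall y\in C\}$, and $C$ is Hermitian LCD if $C\cap C^{\perp_H}=\{\mathbf{0}_n\}$. $d_4(n,k)$ denotes the largest minimum weight among all Hermitian LCD $[n,k]_4$ codes. -}

module Defs where

open import Data.Nat using (ℕ; zero; suc; _≤_)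
open import Data.Vec using (Vec; []; _∷_; replicate)
open import Data.Product using (Σ; ∃; _×_; _,_)
open import Relation.Binary.PropositionalEquality using (_≡_)
open import Relation.Nullary using (¬_)

data F4 : Set where
  𝟘 𝟙 ω ω² : F4

infixl 6 _⊕_
infixl 7 _⊗_

_⊕_ : F4 → F4 → F4
𝟘 ⊕ y = y
x ⊕ 𝟘 = x
𝟙 ⊕ 𝟙 = 𝟘
𝟙 ⊕ ω = ω²
𝟙 ⊕ ω² = ω
ω ⊕ 𝟙 = ω²
ω ⊕ ω = 𝟘
ω ⊕ ω² = 𝟙
ω² ⊕ 𝟙 = ω
ω² ⊕ ω = 𝟙
ω² ⊕ ω² = 𝟘

_⊗_ : F4 → F4 → F4
𝟘 ⊗ y = 𝟘
𝟙 ⊗ y = y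
ω ⊗ 𝟘 = 𝟘
ω ⊗ 𝟙 = ω
ω ⊗ ω = ω²
ω ⊗ ω² = 𝟙
ω² ⊗ 𝟘 = 𝟘
ω² ⊗ 𝟙 = ω²
ω² ⊗ ω = 𝟙
ω² ⊗ ω² = ω

conj : F4 → F4
conj x = x ⊗ x

Word : ℕ → Set
Word n = Vec F4 n

0w : ∀ {n} → Word n
0w = replicate _ 𝟘

_+w_ : ∀ {n} → Word n → Word n → Word n
[] +w [] = []
(x ∷ xs) +w (y ∷ ys) = (x ⊕ y) ∷ (xs +w ys)

_·w_ : ∀ {n} → F4 → Word n → Word n
a ·w [] = []
a ·w (x ∷ xs) = (a ⊗ x) ∷ (a ·w xs)

wt : ∀ {n} → Word n → ℕ
wt [] = 0
wt (𝟘 ∷ xs) = wt xs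
wt (_ ∷ xs) = suc (wt xs)

herm : ∀ {n} → Word n → Word n → F4
herm [] [] = 𝟘
herm (x ∷ xs) (y ∷ ys) = (x ⊗ conj y) ⊕ herm xs ys

GenMat : ℕ → ℕ → Set
GenMat k n = Vec (Word n) k

lincomb : ∀ {k n} → Vec F4 k → GenMat k n → Word n
lincomb [] [] = 0w
lincomb (c ∷ cs) (g ∷ gs) = (c ·w g) +w lincomb cs gs

FullRank : ∀ {k n} → GenMat k n → Set
FullRank {k} G = ∀ (c : Vec F4 k) → lincomb c G ≡ 0w → c ≡ 0w

_∈C_ : ∀ {k n} → Word n → GenMat k n → Set
x ∈C G = ∃ λ c → lincomb c G ≡ x

_∈C⊥H_ : ∀ {k n} → Word n → GenMat k n → Set
x ∈C⊥H G = ∀ y → y ∈C G → herm x y ≡ 𝟘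

HermLCD : ∀ {k n} → GenMat k n → Set
HermLCD G = ∀ x → x ∈C G → x ∈C⊥H G → x ≡ 0w

record Code (n k : ℕ) : Set where
  constructor code
  field
    gen      : GenMat k n
    fullRank : FullRank gen
open Code public

HasMinWeight : ∀ {k n} → GenMat k n → ℕ → Set
HasMinWeight G d =
  (∃ λ x → x ∈C G × ¬ (x ≡ 0w) × wt x ≡ d) ×
  (∀ x → x ∈C G → ¬ (x ≡ 0w) → d ≤ wt x)

-- d = d_4(n,k): the largest minimum weight among Hermitian LCD [n,k]_4 codes
IsD4 : ℕ → ℕ → ℕ → Set
IsD4 n k d =
  (∃ λ (C : Code n k) → HermLCD (gen C) × HasMinWeight (gen C) d) ×
  (∀ (C : Code n k) → HermLCD (gen C) → ∀ d' → HasMinWeight (gen C) d' → d' ≤ d)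

-- Let C be a Hermitian LCD [k + 2, k]₄ code, k ≥ 2, without nonzero words of weight
-- ≤ 2. For each j, solving k − 1 linear equations gives a nonzero codeword vanishing on the last k
-- coordinates except the j-th; its remaining three coordinates are then nonzero, so C contains
-- x_j = (1, r_j, u_j e_j) with r_j, u_j ≠ 0. If r_j = r_l for j ≠ l then x_j + x_l has weight 2,
-- so j ↦ r_j is injective into F4ˣ and k ≤ 3. A codeword is determined by its last k
-- coordinates, so the x_j span C, and their Gram matrix (1 + r_j r̄_l + δ_jl) is singular for
-- k = 2, 3: a kernel vector yields a nonzero word of C ∩ C^⊥H, contradicting LCD.
--
-- The code spanned by the rows (1, ω, e_j) maps c to (Σ c, ω Σ c, c); as ω ω̄ = 1
-- the form restricted to it is the standard form of F4^k, so it is LCD.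

module Submission where

open import Defs
open import Data.Empty using (⊥-elim)
open import Data.Fin as Fin using (Fin; zero; suc; punchIn; punchOut)
open import Data.Fin.Properties as Fin using (punchIn-punchOut; injective⇒≤)
open import Data.Nat using (ℕ; zero; suc; _+_; _≤_; _<_; _∸_; z≤n; s≤s; _≤?_)
open import Data.Nat.Properties
  using (≤-refl; ≤-trans; ≤-reflexive; n≤1+n; m≤m+n; +-mono-≤; ≰⇒>; <⇒≱; +-commutativeSemigroup)
open import Algebra.Properties.CommutativeSemigroup +-commutativeSemigroup
  using () renaming (interchange to +-interchange)
open import Data.Product using (_×_; _,_; ∃)
open import Data.Vec using (Vec; []; _∷_; head; tail; lookup; tabulate; map; _[_]≔_)
open import Data.Vec.Properties
  using (≡-dec; lookup∘tabulate; tabulate∘lookup; tabulate-cong; tabulate-∘;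
         lookup-replicate; lookup∘update; lookup∘update′)
open import Function using (_∘_)
open import Relation.Binary.Definitions using (DecidableEquality)
open import Relation.Binary.PropositionalEquality
open import Relation.Nullary using (Dec; yes; no; ¬_; ¬?)
open import Relation.Nullary.Decidable using (from-yes; map′; _×-dec_; _→-dec_; decidable-stable)
open import Relation.Unary using (Pred; Decidable)

open ≡-Reasoning

private
  variable
    k m n : ℕ

-- The field F4

toFin : F4 → Fin 4
toFin 𝟘  = zero
toFin 𝟙  = suc zero
toFin ω  = suc (suc zero)
toFin ω² = suc (suc (suc zero))

fromFin : Fin 4 → F4
fromFin = lookup (𝟘 ∷ 𝟙 ∷ ω ∷ ω² ∷ [])

fromFin-toFin : ∀ x → fromFin (toFin x) ≡ x
fromFin-toFin 𝟘  = refl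
fromFin-toFin 𝟙  = refl
fromFin-toFin ω  = refl
fromFin-toFin ω² = refl

infix 4 _≟_
_≟_ : DecidableEquality F4
x ≟ y = map′ toFin-injective (cong toFin) (toFin x Fin.≟ toFin y)
  where
  toFin-injective : toFin x ≡ toFin y → x ≡ y
  toFin-injective e = trans (sym (fromFin-toFin x)) (trans (cong fromFin e) (fromFin-toFin y))

-- Identities in F4 are proved by deciding them at every argument.

all? : ∀ {p} {P : Pred F4 p} → Decidable P → Dec (∀ x → P x)
all? P? = map′ (λ { (p₀ , p₁ , p₂ , p₃) → λ { 𝟘 → p₀ ; 𝟙 → p₁ ; ω → p₂ ; ω² → p₃ } })
               (λ h → h 𝟘 , h 𝟙 , h ω , h ω²)
               (P? 𝟘 ×-dec P? 𝟙 ×-dec P? ω ×-dec P? ω²)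

inv : F4 → F4
inv 𝟘  = 𝟘
inv 𝟙  = 𝟙
inv ω  = ω²
inv ω² = ω

⊕-identityʳ : ∀ x → x ⊕ 𝟘 ≡ x
⊕-identityʳ = from-yes (all? λ x → x ⊕ 𝟘 ≟ x)

⊕-self : ∀ x → x ⊕ x ≡ 𝟘
⊕-self = from-yes (all? λ x → x ⊕ x ≟ 𝟘)

⊕-cancel : ∀ x y → x ⊕ y ≡ 𝟘 → x ≡ y
⊕-cancel = from-yes (all? λ x → all? λ y → (x ⊕ y ≟ 𝟘) →-dec (x ≟ y))

⊕-interchange : ∀ x y z w → (x ⊕ y) ⊕ (z ⊕ w) ≡ (x ⊕ z) ⊕ (y ⊕ w)
⊕-interchange = from-yes (all? λ x → all? λ y → all? λ z → all? λ w →
  (x ⊕ y) ⊕ (z ⊕ w) ≟ (x ⊕ z) ⊕ (y ⊕ w))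

⊗-zeroʳ : ∀ x → x ⊗ 𝟘 ≡ 𝟘
⊗-zeroʳ = from-yes (all? λ x → x ⊗ 𝟘 ≟ 𝟘)

⊗-identityʳ : ∀ x → x ⊗ 𝟙 ≡ x
⊗-identityʳ = from-yes (all? λ x → x ⊗ 𝟙 ≟ x)

⊗-comm : ∀ x y → x ⊗ y ≡ y ⊗ x
⊗-comm = from-yes (all? λ x → all? λ y → x ⊗ y ≟ y ⊗ x)

⊗-assoc : ∀ x y z → (x ⊗ y) ⊗ z ≡ x ⊗ (y ⊗ z)
⊗-assoc = from-yes (all? λ x → all? λ y → all? λ z → (x ⊗ y) ⊗ z ≟ x ⊗ (y ⊗ z))

⊗-swap : ∀ x y z → x ⊗ (y ⊗ z) ≡ y ⊗ (x ⊗ z)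
⊗-swap = from-yes (all? λ x → all? λ y → all? λ z → x ⊗ (y ⊗ z) ≟ y ⊗ (x ⊗ z))

⊗-distribˡ-⊕ : ∀ x y z → x ⊗ (y ⊕ z) ≡ x ⊗ y ⊕ x ⊗ z
⊗-distribˡ-⊕ = from-yes (all? λ x → all? λ y → all? λ z → x ⊗ (y ⊕ z) ≟ x ⊗ y ⊕ x ⊗ z)

⊗-distribʳ-⊕ : ∀ x y z → (y ⊕ z) ⊗ x ≡ y ⊗ x ⊕ z ⊗ x
⊗-distribʳ-⊕ = from-yes (all? λ x → all? λ y → all? λ z → (y ⊕ z) ⊗ x ≟ y ⊗ x ⊕ z ⊗ x)

⊗-nonzero : ∀ x y → x ≢ 𝟘 → y ≢ 𝟘 → x ⊗ y ≢ 𝟘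
⊗-nonzero = from-yes (all? λ x → all? λ y → ¬? (x ≟ 𝟘) →-dec ¬? (y ≟ 𝟘) →-dec ¬? (x ⊗ y ≟ 𝟘))

⊗-inverseˡ : ∀ x → x ≢ 𝟘 → inv x ⊗ x ≡ 𝟙
⊗-inverseˡ = from-yes (all? λ x → ¬? (x ≟ 𝟘) →-dec (inv x ⊗ x ≟ 𝟙))

⊗-inverseʳ : ∀ x → x ≢ 𝟘 → x ⊗ inv x ≡ 𝟙
⊗-inverseʳ x x≢𝟘 = trans (⊗-comm x (inv x)) (⊗-inverseˡ x x≢𝟘)

conj-⊕ : ∀ x y → conj (x ⊕ y) ≡ conj x ⊕ conj y
conj-⊕ = from-yes (all? λ x → all? λ y → conj (x ⊕ y) ≟ conj x ⊕ conj y)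

conj-⊗ : ∀ x y → conj (x ⊗ y) ≡ conj x ⊗ conj y
conj-⊗ = from-yes (all? λ x → all? λ y → conj (x ⊗ y) ≟ conj x ⊗ conj y)

⊗-conj-self : ∀ x → x ≢ 𝟘 → x ⊗ conj x ≡ 𝟙
⊗-conj-self = from-yes (all? λ x → ¬? (x ≟ 𝟘) →-dec (x ⊗ conj x ≟ 𝟙))

-- Words: coordinates, linear operations and weight

lookup-0w : ∀ (i : Fin n) → lookup 0w i ≡ 𝟘
lookup-0w i = lookup-replicate i 𝟘

lookup-+w : ∀ (x y : Word n) i → lookup (x +w y) i ≡ lookup x i ⊕ lookup y i
lookup-+w (a ∷ x) (b ∷ y) zero    = refl
lookup-+w (a ∷ x) (b ∷ y) (suc i) = lookup-+w x y i

lookup-·w : ∀ a (x : Word n) i → lookup (a ·w x) i ≡ a ⊗ lookup x i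
lookup-·w a (b ∷ x) zero    = refl
lookup-·w a (b ∷ x) (suc i) = lookup-·w a x i

≡-by-lookup : ∀ {x y : Word n} → (∀ i → lookup x i ≡ lookup y i) → x ≡ y
≡-by-lookup {x = x} {y} h = begin
  x                   ≡⟨ tabulate∘lookup x ⟨
  tabulate (lookup x) ≡⟨ tabulate-cong h ⟩
  tabulate (lookup y) ≡⟨ tabulate∘lookup y ⟩
  y                   ∎

+w-identityˡ : ∀ (x : Word n) → 0w +w x ≡ x
+w-identityˡ []      = refl
+w-identityˡ (a ∷ x) = cong (a ∷_) (+w-identityˡ x)

+w-self : ∀ (x : Word n) → x +w x ≡ 0w
+w-self []      = refl
+w-self (a ∷ x) = cong₂ _∷_ (⊕-self a) (+w-self x)

+w-cancel : ∀ (x y : Word n) → x +w y ≡ 0w → x ≡ y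
+w-cancel []      []      _ = refl
+w-cancel (a ∷ x) (b ∷ y) e = cong₂ _∷_ (⊕-cancel a b (cong head e)) (+w-cancel x y (cong tail e))

+w-interchange : ∀ (x y z w : Word n) → (x +w y) +w (z +w w) ≡ (x +w z) +w (y +w w)
+w-interchange []      []      []      []      = refl
+w-interchange (a ∷ x) (b ∷ y) (c ∷ z) (d ∷ w) =
  cong₂ _∷_ (⊕-interchange a b c d) (+w-interchange x y z w)

·w-zeroʳ : ∀ a → a ·w 0w {n} ≡ 0w
·w-zeroʳ {zero}  a = refl
·w-zeroʳ {suc n} a = cong₂ _∷_ (⊗-zeroʳ a) (·w-zeroʳ a)

·w-zeroˡ : ∀ (x : Word n) → 𝟘 ·w x ≡ 0w
·w-zeroˡ []      = refl
·w-zeroˡ (a ∷ x) = cong (𝟘 ∷_) (·w-zeroˡ x)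

·w-assoc : ∀ a b (x : Word n) → (a ⊗ b) ·w x ≡ a ·w (b ·w x)
·w-assoc a b []      = refl
·w-assoc a b (c ∷ x) = cong₂ _∷_ (⊗-assoc a b c) (·w-assoc a b x)

·w-distribˡ : ∀ a (x y : Word n) → a ·w (x +w y) ≡ (a ·w x) +w (a ·w y)
·w-distribˡ a []      []      = refl
·w-distribˡ a (b ∷ x) (c ∷ y) = cong₂ _∷_ (⊗-distribˡ-⊕ a b c) (·w-distribˡ a x y)

·w-distribʳ : ∀ a b (x : Word n) → (a ⊕ b) ·w x ≡ (a ·w x) +w (b ·w x)
·w-distribʳ a b []      = refl
·w-distribʳ a b (c ∷ x) = cong₂ _∷_ (⊗-distribʳ-⊕ c a b) (·w-distribʳ a b x)

·w-[]≔ : ∀ a (j : Fin n) u → a ·w (0w [ j ]≔ u) ≡ 0w [ j ]≔ (a ⊗ u)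
·w-[]≔ a zero    u = cong (a ⊗ u ∷_) (·w-zeroʳ a)
·w-[]≔ a (suc j) u = cong₂ _∷_ (⊗-zeroʳ a) (·w-[]≔ a j u)

[]≔𝟘 : ∀ (j : Fin n) → 0w [ j ]≔ 𝟘 ≡ 0w
[]≔𝟘 zero    = refl
[]≔𝟘 (suc j) = cong (𝟘 ∷_) ([]≔𝟘 j)

≡-[]≔-lookup : ∀ (v : Word (suc n)) j → (∀ l → lookup v (punchIn j l) ≡ 𝟘) → v ≡ 0w [ j ]≔ lookup v j
≡-[]≔-lookup v j vanishes = ≡-by-lookup λ i → at i (j Fin.≟ i)
  where
  at : ∀ i → Dec (j ≡ i) → lookup v i ≡ lookup (0w [ j ]≔ lookup v j) i
  at i (yes refl) = sym (lookup∘update i 0w (lookup v i))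
  at i (no j≢i)   = begin
    lookup v i                            ≡⟨ cong (lookup v) (punchIn-punchOut j≢i) ⟨
    lookup v (punchIn j (punchOut j≢i))   ≡⟨ vanishes (punchOut j≢i) ⟩
    𝟘                                     ≡⟨ lookup-0w i ⟨
    lookup 0w i                           ≡⟨ lookup∘update′ (j≢i ∘ sym) 0w (lookup v j) ⟨
    lookup (0w [ j ]≔ lookup v j) i       ∎

wt-∷ : ∀ a (v : Word n) → wt (a ∷ v) ≡ wt (a ∷ []) + wt v
wt-∷ 𝟘  v = refl
wt-∷ 𝟙  v = refl
wt-∷ ω  v = refl
wt-∷ ω² v = refl

wt-∷≤ : ∀ a (v : Word n) → wt (a ∷ v) ≤ suc (wt v)
wt-∷≤ 𝟘  v = n≤1+n (wt v)
wt-∷≤ 𝟙  v = ≤-refl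
wt-∷≤ ω  v = ≤-refl
wt-∷≤ ω² v = ≤-refl

wt-≤∷ : ∀ a (v : Word n) → wt v ≤ wt (a ∷ v)
wt-≤∷ 𝟘  v = ≤-refl
wt-≤∷ 𝟙  v = n≤1+n (wt v)
wt-≤∷ ω  v = n≤1+n (wt v)
wt-≤∷ ω² v = n≤1+n (wt v)

wt-∷-nonzero : ∀ {a} (v : Word n) → a ≢ 𝟘 → wt (a ∷ v) ≡ suc (wt v)
wt-∷-nonzero {a = 𝟘}  v a≢𝟘 = ⊥-elim (a≢𝟘 refl)
wt-∷-nonzero {a = 𝟙}  v _   = refl
wt-∷-nonzero {a = ω}  v _   = refl
wt-∷-nonzero {a = ω²} v _   = refl

wt-0w : ∀ n → wt (0w {n}) ≡ 0
wt-0w zero    = refl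
wt-0w (suc n) = wt-0w n

wt-[]≔ : ∀ (j : Fin n) u → wt (0w [ j ]≔ u) ≤ 1
wt-[]≔ {suc n} zero    u = ≤-trans (wt-∷≤ u 0w) (s≤s (≤-reflexive (wt-0w n)))
wt-[]≔         (suc j) u = wt-[]≔ j u

wt-∷∷0w : ∀ a b → wt (a ∷ b ∷ 0w {n}) ≤ 2
wt-∷∷0w {n} a b = ≤-trans (wt-∷≤ a _) (s≤s (≤-trans (wt-∷≤ b _) (s≤s (≤-reflexive (wt-0w n)))))

wt-+w : ∀ (x y : Word n) → wt (x +w y) ≤ wt x + wt y
wt-+w []      []      = z≤n
wt-+w (a ∷ x) (b ∷ y) =
  subst₂ _≤_ (sym (wt-∷ (a ⊕ b) (x +w y)))
             (trans (+-interchange (wt (a ∷ [])) (wt (b ∷ [])) (wt x) (wt y))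
                    (cong₂ _+_ (sym (wt-∷ a x)) (sym (wt-∷ b y))))
             (+-mono-≤ (wt₁-⊕ a b) (wt-+w x y))
  where
  wt₁-⊕ : ∀ a b → wt (a ⊕ b ∷ []) ≤ wt (a ∷ []) + wt (b ∷ [])
  wt₁-⊕ = from-yes (all? λ a → all? λ b → wt (a ⊕ b ∷ []) ≤? wt (a ∷ []) + wt (b ∷ []))

wt≤length : ∀ (x : Word n) → wt x ≤ n
wt≤length []      = z≤n
wt≤length (a ∷ x) = ≤-trans (wt-∷≤ a x) (s≤s (wt≤length x))

≢0w⇒1≤wt : ∀ (x : Word n) → x ≢ 0w → 1 ≤ wt x
≢0w⇒1≤wt []       x≢0 = ⊥-elim (x≢0 refl)
≢0w⇒1≤wt (𝟘  ∷ x) x≢0 = ≢0w⇒1≤wt x (x≢0 ∘ cong (𝟘 ∷_))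
≢0w⇒1≤wt (𝟙  ∷ x) _   = s≤s z≤n
≢0w⇒1≤wt (ω  ∷ x) _   = s≤s z≤n
≢0w⇒1≤wt (ω² ∷ x) _   = s≤s z≤n

sum : Vec F4 k → F4
sum []      = 𝟘
sum (a ∷ v) = a ⊕ sum v

sum-0w : ∀ k → sum (0w {k}) ≡ 𝟘
sum-0w zero    = refl
sum-0w (suc k) = sum-0w k

sum≡𝟘⇒2≤wt : ∀ (c : Vec F4 k) → c ≢ 0w → sum c ≡ 𝟘 → 2 ≤ wt c
sum≡𝟘⇒2≤wt []      c≢0 _ = ⊥-elim (c≢0 refl)
sum≡𝟘⇒2≤wt {suc k} (a ∷ c) c≢0 sum≡𝟘 with a ≟ 𝟘
... | yes refl = sum≡𝟘⇒2≤wt c (c≢0 ∘ cong (𝟘 ∷_)) sum≡𝟘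
... | no a≢𝟘   = subst (2 ≤_) (sym (wt-∷-nonzero c a≢𝟘)) (s≤s (≢0w⇒1≤wt c rest≢0))
  where
  rest≢0 : c ≢ 0w
  rest≢0 refl = a≢𝟘 (trans (sym (⊕-identityʳ a)) (trans (cong (a ⊕_) (sym (sum-0w k))) sum≡𝟘))

-- Codes and homogeneous linear systems

lincomb-0w : ∀ (G : GenMat k n) → lincomb 0w G ≡ 0w
lincomb-0w []      = refl
lincomb-0w (g ∷ G) = trans (cong₂ _+w_ (·w-zeroˡ g) (lincomb-0w G)) (+w-identityˡ 0w)

lincomb-+w : ∀ (c c′ : Vec F4 k) (G : GenMat k n) →
             lincomb (c +w c′) G ≡ lincomb c G +w lincomb c′ G
lincomb-+w []      []       []      = sym (+w-identityˡ 0w)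
lincomb-+w (a ∷ c) (b ∷ c′) (g ∷ G) = begin
  ((a ⊕ b) ·w g) +w lincomb (c +w c′) G
    ≡⟨ cong₂ _+w_ (·w-distribʳ a b g) (lincomb-+w c c′ G) ⟩
  ((a ·w g) +w (b ·w g)) +w (lincomb c G +w lincomb c′ G)
    ≡⟨ +w-interchange (a ·w g) (b ·w g) (lincomb c G) (lincomb c′ G) ⟩
  ((a ·w g) +w lincomb c G) +w ((b ·w g) +w lincomb c′ G) ∎

lincomb-·w : ∀ a (c : Vec F4 k) (G : GenMat k n) → lincomb (a ·w c) G ≡ a ·w lincomb c G
lincomb-·w a []      []      = sym (·w-zeroʳ a)
lincomb-·w a (b ∷ c) (g ∷ G) = begin
  ((a ⊗ b) ·w g) +w lincomb (a ·w c) G ≡⟨ cong₂ _+w_ (·w-assoc a b g) (lincomb-·w a c G) ⟩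
  (a ·w (b ·w g)) +w (a ·w lincomb c G) ≡⟨ ·w-distribˡ a (b ·w g) (lincomb c G) ⟨
  a ·w ((b ·w g) +w lincomb c G)        ∎

module _ {G : GenMat k n} where

  ∈C-+w : ∀ {x y} → x ∈C G → y ∈C G → (x +w y) ∈C G
  ∈C-+w (c , refl) (c′ , refl) = c +w c′ , lincomb-+w c c′ G

  ∈C-·w : ∀ {x} a → x ∈C G → (a ·w x) ∈C G
  ∈C-·w a (c , refl) = a ·w c , lincomb-·w a c G

  lincomb≢0w⇒≢0w : ∀ {c : Vec F4 k} → lincomb c G ≢ 0w → c ≢ 0w
  lincomb≢0w⇒≢0w x≢0 refl = x≢0 (lincomb-0w G)

  lincomb-∈C : ∀ (μ : Vec F4 m) (X : GenMat m n) → (∀ i → lookup X i ∈C G) → lincomb μ X ∈C G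
  lincomb-∈C []      []      _    = 0w , lincomb-0w G
  lincomb-∈C (a ∷ μ) (x ∷ X) X∈C = ∈C-+w (∈C-·w a (X∈C zero)) (lincomb-∈C μ X (X∈C ∘ suc))

dot : Vec F4 k → Vec F4 k → F4
dot []      []      = 𝟘
dot (a ∷ u) (b ∷ v) = a ⊗ b ⊕ dot u v

column : Fin n → GenMat k n → Vec F4 k
column i = map (λ g → lookup g i)

lookup-lincomb : ∀ (c : Vec F4 k) (G : GenMat k n) i → lookup (lincomb c G) i ≡ dot c (column i G)
lookup-lincomb []      []      i = lookup-0w i
lookup-lincomb (a ∷ c) (g ∷ G) i =
  trans (lookup-+w (a ·w g) (lincomb c G) i) (cong₂ _⊕_ (lookup-·w a g i) (lookup-lincomb c G i))

dot-zeroˡ : ∀ (v : Vec F4 k) → dot 0w v ≡ 𝟘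
dot-zeroˡ []      = refl
dot-zeroˡ (a ∷ v) = dot-zeroˡ v

dot-∷ : ∀ a (c : Vec F4 k) v → dot (a ∷ c) v ≡ a ⊗ head v ⊕ dot c (tail v)
dot-∷ a c (b ∷ v) = refl

dot-linearʳ : ∀ (c : Vec F4 k) a v w → dot c ((a ·w v) +w w) ≡ a ⊗ dot c v ⊕ dot c w
dot-linearʳ []       a []      []      = sym (trans (⊕-identityʳ (a ⊗ 𝟘)) (⊗-zeroʳ a))
dot-linearʳ (c ∷ cs) a (b ∷ v) (d ∷ w) = begin
  c ⊗ (a ⊗ b ⊕ d) ⊕ dot cs ((a ·w v) +w w)
    ≡⟨ cong₂ _⊕_ (⊗-distribˡ-⊕ c (a ⊗ b) d) (dot-linearʳ cs a v w) ⟩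
  (c ⊗ (a ⊗ b) ⊕ c ⊗ d) ⊕ (a ⊗ dot cs v ⊕ dot cs w)
    ≡⟨ cong (λ t → (t ⊕ c ⊗ d) ⊕ (a ⊗ dot cs v ⊕ dot cs w)) (⊗-swap c a b) ⟩
  (a ⊗ (c ⊗ b) ⊕ c ⊗ d) ⊕ (a ⊗ dot cs v ⊕ dot cs w)
    ≡⟨ ⊕-interchange (a ⊗ (c ⊗ b)) (c ⊗ d) (a ⊗ dot cs v) (dot cs w) ⟩
  (a ⊗ (c ⊗ b) ⊕ a ⊗ dot cs v) ⊕ (c ⊗ d ⊕ dot cs w)
    ≡⟨ cong (_⊕ (c ⊗ d ⊕ dot cs w)) (⊗-distribˡ-⊕ a (c ⊗ b) (dot cs v)) ⟨
  a ⊗ (c ⊗ b ⊕ dot cs v) ⊕ (c ⊗ d ⊕ dot cs w) ∎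

-- Eliminates the first unknown from e using the pivot equation (subtraction is addition in F4).
reduce : Vec F4 (suc k) → Vec F4 (suc k) → Vec F4 k
reduce pivot e = ((head e ⊗ inv (head pivot)) ·w tail pivot) +w tail e

backSubstitute : Vec F4 (suc k) → Vec F4 k → Vec F4 (suc k)
backSubstitute pivot c = (inv (head pivot) ⊗ dot c (tail pivot)) ∷ c

dot-backSubstitute : ∀ pivot (c : Vec F4 k) e →
                     dot (backSubstitute pivot c) e ≡ dot c (reduce pivot e)
dot-backSubstitute pivot c e = begin
  dot (backSubstitute pivot c) e                   ≡⟨ dot-∷ (inv q ⊗ s) c e ⟩
  (inv q ⊗ s) ⊗ head e ⊕ dot c (tail e)            ≡⟨ cong (_⊕ dot c (tail e)) rearrange ⟩
  (head e ⊗ inv q) ⊗ s ⊕ dot c (tail e)            ≡⟨ dot-linearʳ c (head e ⊗ inv q) (tail pivot) (tail e) ⟨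
  dot c (reduce pivot e)                           ∎
  where
  q = head pivot
  s = dot c (tail pivot)
  rearrange : (inv q ⊗ s) ⊗ head e ≡ (head e ⊗ inv q) ⊗ s
  rearrange = begin
    (inv q ⊗ s) ⊗ head e ≡⟨ ⊗-comm (inv q ⊗ s) (head e) ⟩
    head e ⊗ (inv q ⊗ s) ≡⟨ ⊗-assoc (head e) (inv q) s ⟨
    (head e ⊗ inv q) ⊗ s ∎

dot-backSubstitute-pivot : ∀ pivot (c : Vec F4 k) → head pivot ≢ 𝟘 →
                           dot (backSubstitute pivot c) pivot ≡ 𝟘
dot-backSubstitute-pivot (q ∷ r) c q≢𝟘 = begin
  (inv q ⊗ s) ⊗ q ⊕ s  ≡⟨ cong (_⊕ s) (⊗-comm (inv q ⊗ s) q) ⟩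
  q ⊗ (inv q ⊗ s) ⊕ s  ≡⟨ cong (_⊕ s) (⊗-assoc q (inv q) s) ⟨
  (q ⊗ inv q) ⊗ s ⊕ s  ≡⟨ cong (λ t → t ⊗ s ⊕ s) (⊗-inverseʳ q q≢𝟘) ⟩
  s ⊕ s                ≡⟨ ⊕-self s ⟩
  𝟘                    ∎
  where
  s = dot c r

nontrivialSolution : m < k → (E : Fin m → Vec F4 k) → ∃ λ c → c ≢ 0w × ∀ i → dot c (E i) ≡ 𝟘
nontrivialSolution {zero}  {suc k} _ E = 𝟙 ∷ 0w , (λ ()) , λ ()
nontrivialSolution {suc m} {suc k} (s≤s m<k) E with Fin.any? (λ i → ¬? (head (E i) ≟ 𝟘))
... | no no-pivot = 𝟙 ∷ 0w , (λ ()) , λ i → begin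
  dot (𝟙 ∷ 0w) (E i)                 ≡⟨ dot-∷ 𝟙 0w (E i) ⟩
  head (E i) ⊕ dot 0w (tail (E i))   ≡⟨ cong₂ _⊕_ (decidable-stable (head (E i) ≟ 𝟘) (no-pivot ∘ (i ,_)))
                                                (dot-zeroˡ (tail (E i))) ⟩
  𝟘                                  ∎
... | yes (p , pivot≢𝟘)
  with c , c≢0 , c-solves ← nontrivialSolution m<k (λ i → reduce (E p) (E (punchIn p i)))
  = backSubstitute (E p) c , c≢0 ∘ cong tail , solves
  where
  solves : ∀ i → dot (backSubstitute (E p) c) (E i) ≡ 𝟘
  solves i with p Fin.≟ i
  ... | yes refl = dot-backSubstitute-pivot (E p) c pivot≢𝟘
  ... | no p≢i   = begin
    dot (backSubstitute (E p) c) (E i)                  ≡⟨ dot-backSubstitute (E p) c (E i) ⟩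
    dot c (reduce (E p) (E i))                          ≡⟨ cong (dot c ∘ reduce (E p) ∘ E) (punchIn-punchOut p≢i) ⟨
    dot c (reduce (E p) (E (punchIn p (punchOut p≢i)))) ≡⟨ c-solves (punchOut p≢i) ⟩
    𝟘                                                   ∎

vanishingCodeword : (C : Code n k) → m < k → (f : Fin m → Fin n) →
                    ∃ λ x → x ∈C gen C × x ≢ 0w × ∀ i → lookup x (f i) ≡ 𝟘
vanishingCodeword C m<k f
  with c , c≢0 , c-solves ← nontrivialSolution m<k (λ i → column (f i) (gen C))
  = lincomb c (gen C) , (c , refl) , c≢0 ∘ fullRank C c ,
    λ i → trans (lookup-lincomb c (gen C) (f i)) (c-solves i)

-- Systematic generator matrices and the Hermitian form

dot-const : ∀ (μ : Vec F4 k) a → dot μ (tabulate λ _ → a) ≡ a ⊗ sum μ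
dot-const []      a = sym (⊗-zeroʳ a)
dot-const (c ∷ μ) a = begin
  c ⊗ a ⊕ dot μ (tabulate λ _ → a) ≡⟨ cong₂ _⊕_ (⊗-comm c a) (dot-const μ a) ⟩
  a ⊗ c ⊕ a ⊗ sum μ                ≡⟨ ⊗-distribˡ-⊕ a c (sum μ) ⟨
  a ⊗ (c ⊕ sum μ)                  ∎

lincomb-tabulate-∷ : ∀ (μ : Vec F4 k) (h : Fin k → F4) (t : Fin k → Word n) →
                     lincomb μ (tabulate λ j → h j ∷ t j) ≡ dot μ (tabulate h) ∷ lincomb μ (tabulate t)
lincomb-tabulate-∷ []      h t = refl
lincomb-tabulate-∷ (c ∷ μ) h t =
  cong ((c ·w (h zero ∷ t zero)) +w_) (lincomb-tabulate-∷ μ (h ∘ suc) (t ∘ suc))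

lincomb-diagonal : ∀ (μ : Vec F4 k) (u : Fin k → F4) →
                   lincomb μ (tabulate λ j → 0w [ j ]≔ u j) ≡ tabulate λ j → lookup μ j ⊗ u j
lincomb-diagonal []      u = refl
lincomb-diagonal (c ∷ μ) u = begin
  (c ·w (u zero ∷ 0w)) +w lincomb μ (tabulate λ j → 𝟘 ∷ 0w [ j ]≔ u (suc j))
    ≡⟨ cong ((c ·w (u zero ∷ 0w)) +w_) (lincomb-tabulate-∷ μ (λ _ → 𝟘) (λ j → 0w [ j ]≔ u (suc j))) ⟩
  (c ⊗ u zero ⊕ dot μ (tabulate λ _ → 𝟘)) ∷ ((c ·w 0w) +w lincomb μ (tabulate λ j → 0w [ j ]≔ u (suc j)))
    ≡⟨ cong₂ (λ a w → (c ⊗ u zero ⊕ a) ∷ (w +w lincomb μ (tabulate λ j → 0w [ j ]≔ u (suc j))))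
             (dot-const μ 𝟘) (·w-zeroʳ c) ⟩
  (c ⊗ u zero ⊕ 𝟘) ∷ (0w +w lincomb μ (tabulate λ j → 0w [ j ]≔ u (suc j)))
    ≡⟨ cong₂ _∷_ (⊕-identityʳ (c ⊗ u zero))
                 (trans (+w-identityˡ _) (lincomb-diagonal μ (u ∘ suc))) ⟩
  (c ⊗ u zero) ∷ tabulate (λ j → lookup μ j ⊗ u (suc j)) ∎

systematic : (r u : Fin k → F4) → GenMat k (2 + k)
systematic r u = tabulate λ j → 𝟙 ∷ r j ∷ 0w [ j ]≔ u j

lincomb-systematic : ∀ (μ : Vec F4 k) r u →
  lincomb μ (systematic r u) ≡ sum μ ∷ dot μ (tabulate r) ∷ tabulate (λ j → lookup μ j ⊗ u j)
lincomb-systematic μ r u = begin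
  lincomb μ (systematic r u)
    ≡⟨ lincomb-tabulate-∷ μ (λ _ → 𝟙) (λ j → r j ∷ 0w [ j ]≔ u j) ⟩
  dot μ (tabulate λ _ → 𝟙) ∷ lincomb μ (tabulate λ j → r j ∷ 0w [ j ]≔ u j)
    ≡⟨ cong₂ _∷_ (dot-const μ 𝟙) (lincomb-tabulate-∷ μ r (λ j → 0w [ j ]≔ u j)) ⟩
  sum μ ∷ dot μ (tabulate r) ∷ lincomb μ (tabulate λ j → 0w [ j ]≔ u j)
    ≡⟨ cong (λ w → sum μ ∷ dot μ (tabulate r) ∷ w) (lincomb-diagonal μ u) ⟩
  sum μ ∷ dot μ (tabulate r) ∷ tabulate (λ j → lookup μ j ⊗ u j) ∎

herm-0wˡ : ∀ (y : Word n) → herm 0w y ≡ 𝟘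
herm-0wˡ []      = refl
herm-0wˡ (b ∷ y) = herm-0wˡ y

herm-0wʳ : ∀ (x : Word n) → herm x 0w ≡ 𝟘
herm-0wʳ []      = refl
herm-0wʳ (a ∷ x) = cong₂ _⊕_ (⊗-zeroʳ a) (herm-0wʳ x)

herm-+wˡ : ∀ (x y z : Word n) → herm (x +w y) z ≡ herm x z ⊕ herm y z
herm-+wˡ []      []      []      = refl
herm-+wˡ (a ∷ x) (b ∷ y) (c ∷ z) = begin
  (a ⊕ b) ⊗ conj c ⊕ herm (x +w y) z
    ≡⟨ cong₂ _⊕_ (⊗-distribʳ-⊕ (conj c) a b) (herm-+wˡ x y z) ⟩
  (a ⊗ conj c ⊕ b ⊗ conj c) ⊕ (herm x z ⊕ herm y z)
    ≡⟨ ⊕-interchange (a ⊗ conj c) (b ⊗ conj c) (herm x z) (herm y z) ⟩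
  (a ⊗ conj c ⊕ herm x z) ⊕ (b ⊗ conj c ⊕ herm y z) ∎

herm-·wˡ : ∀ a (x y : Word n) → herm (a ·w x) y ≡ a ⊗ herm x y
herm-·wˡ a []      []      = sym (⊗-zeroʳ a)
herm-·wˡ a (b ∷ x) (c ∷ y) = begin
  (a ⊗ b) ⊗ conj c ⊕ herm (a ·w x) y ≡⟨ cong₂ _⊕_ (⊗-assoc a b (conj c)) (herm-·wˡ a x y) ⟩
  a ⊗ (b ⊗ conj c) ⊕ a ⊗ herm x y    ≡⟨ ⊗-distribˡ-⊕ a (b ⊗ conj c) (herm x y) ⟨
  a ⊗ (b ⊗ conj c ⊕ herm x y)        ∎

herm-+wʳ : ∀ (x y z : Word n) → herm x (y +w z) ≡ herm x y ⊕ herm x z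
herm-+wʳ []      []      []      = refl
herm-+wʳ (a ∷ x) (b ∷ y) (c ∷ z) = begin
  a ⊗ conj (b ⊕ c) ⊕ herm x (y +w z)
    ≡⟨ cong₂ _⊕_ (trans (cong (a ⊗_) (conj-⊕ b c)) (⊗-distribˡ-⊕ a (conj b) (conj c)))
                 (herm-+wʳ x y z) ⟩
  (a ⊗ conj b ⊕ a ⊗ conj c) ⊕ (herm x y ⊕ herm x z)
    ≡⟨ ⊕-interchange (a ⊗ conj b) (a ⊗ conj c) (herm x y) (herm x z) ⟩
  (a ⊗ conj b ⊕ herm x y) ⊕ (a ⊗ conj c ⊕ herm x z) ∎

herm-·wʳ : ∀ a (x y : Word n) → herm x (a ·w y) ≡ conj a ⊗ herm x y
herm-·wʳ a []      []      = sym (⊗-zeroʳ (conj a))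
herm-·wʳ a (b ∷ x) (c ∷ y) = begin
  b ⊗ conj (a ⊗ c) ⊕ herm x (a ·w y)
    ≡⟨ cong₂ _⊕_ (trans (cong (b ⊗_) (conj-⊗ a c)) (⊗-swap b (conj a) (conj c))) (herm-·wʳ a x y) ⟩
  conj a ⊗ (b ⊗ conj c) ⊕ conj a ⊗ herm x y
    ≡⟨ ⊗-distribˡ-⊕ (conj a) (b ⊗ conj c) (herm x y) ⟨
  conj a ⊗ (b ⊗ conj c ⊕ herm x y) ∎

herm-lincombˡ : ∀ (ν : Vec F4 k) (X : GenMat k n) y →
                herm (lincomb ν X) y ≡ dot ν (map (λ x → herm x y) X)
herm-lincombˡ []      []      y = herm-0wˡ y
herm-lincombˡ (a ∷ ν) (x ∷ X) y =
  trans (herm-+wˡ (a ·w x) (lincomb ν X) y) (cong₂ _⊕_ (herm-·wˡ a x y) (herm-lincombˡ ν X y))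

herm-lincombʳ : ∀ z (μ : Vec F4 k) (X : GenMat k n) →
                (∀ i → herm z (lookup X i) ≡ 𝟘) → herm z (lincomb μ X) ≡ 𝟘
herm-lincombʳ z []      []      _    = herm-0wʳ z
herm-lincombʳ z (a ∷ μ) (x ∷ X) z⊥X = begin
  herm z ((a ·w x) +w lincomb μ X)        ≡⟨ herm-+wʳ z (a ·w x) (lincomb μ X) ⟩
  herm z (a ·w x) ⊕ herm z (lincomb μ X)  ≡⟨ cong₂ _⊕_ (herm-·wʳ a z x) (herm-lincombʳ z μ X (z⊥X ∘ suc)) ⟩
  conj a ⊗ herm z x ⊕ 𝟘                   ≡⟨ cong (λ t → conj a ⊗ t ⊕ 𝟘) (z⊥X zero) ⟩
  conj a ⊗ 𝟘 ⊕ 𝟘                          ≡⟨ cong (_⊕ 𝟘) (⊗-zeroʳ (conj a)) ⟩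
  𝟘                                       ∎

herm-[]≔ʳ : ∀ (x : Word n) l v → herm x (0w [ l ]≔ v) ≡ lookup x l ⊗ conj v
herm-[]≔ʳ (a ∷ x) zero    v = trans (cong (a ⊗ conj v ⊕_) (herm-0wʳ x)) (⊕-identityʳ (a ⊗ conj v))
herm-[]≔ʳ (a ∷ x) (suc l) v = trans (cong (_⊕ herm x (0w [ l ]≔ v)) (⊗-zeroʳ a)) (herm-[]≔ʳ x l v)

herm-nondegenerate : ∀ (x : Word n) → (∀ y → herm x y ≡ 𝟘) → x ≡ 0w
herm-nondegenerate x x⊥ = ≡-by-lookup λ i → begin
  lookup x i                 ≡⟨ ⊗-identityʳ (lookup x i) ⟨
  lookup x i ⊗ conj 𝟙        ≡⟨ herm-[]≔ʳ x i 𝟙 ⟨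
  herm x (0w [ i ]≔ 𝟙)       ≡⟨ x⊥ (0w [ i ]≔ 𝟙) ⟩
  𝟘                          ≡⟨ lookup-0w i ⟨
  lookup 0w i                ∎

-- Codes without nonzero words of weight at most 2

Weight≥3 : GenMat k n → Set
Weight≥3 G = ∀ x → x ∈C G → wt x ≤ 2 → x ≡ 0w

HasMinWeight⇒Weight≥3 : ∀ {G : GenMat k n} {d} → HasMinWeight G d → 2 < d → Weight≥3 G
HasMinWeight⇒Weight≥3 (_ , d≤wt) 2<d x x∈C wt≤2 with ≡-dec _≟_ x 0w
... | yes x≡0 = x≡0
... | no x≢0  = ⊥-elim (<⇒≱ 2<d (≤-trans (d≤wt x x∈C x≢0) wt≤2))

minWeight≤length : ∀ {G : GenMat k n} {d} → HasMinWeight G d → d ≤ n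
minWeight≤length ((x , _ , _ , refl) , _) = wt≤length x

record SystematicRow (G : GenMat k (2 + k)) (j : Fin k) : Set where
  constructor systematicRow
  field
    r u   : F4
    r≢𝟘  : r ≢ 𝟘
    u≢𝟘  : u ≢ 𝟘
    row∈C : (𝟙 ∷ r ∷ 0w [ j ]≔ u) ∈C G

module _ {G : GenMat k (2 + k)} (heavy : Weight≥3 G) where

  tail-determines-codeword : ∀ {x y} → x ∈C G → y ∈C G → tail (tail x) ≡ tail (tail y) → x ≡ y
  tail-determines-codeword {a ∷ b ∷ v} {a′ ∷ b′ ∷ .v} x∈C y∈C refl =
    +w-cancel _ _ (heavy _ (∈C-+w x∈C y∈C)
      (subst (λ w → wt ((a ⊕ a′) ∷ (b ⊕ b′) ∷ w) ≤ 2) (sym (+w-self v)) (wt-∷∷0w (a ⊕ a′) (b ⊕ b′))))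

  normalise : ∀ {a b u} j → (a ∷ b ∷ 0w [ j ]≔ u) ∈C G → (a ∷ b ∷ 0w [ j ]≔ u) ≢ 0w → SystematicRow G j
  normalise {a} {b} {u} j x∈C x≢0 with a ≟ 𝟘
  ... | yes refl = ⊥-elim (x≢0 (heavy _ x∈C (≤-trans (wt-∷≤ b _) (s≤s (wt-[]≔ j u)))))
  ... | no a≢𝟘   = systematicRow (inv a ⊗ b) (inv a ⊗ u) r≢𝟘 u≢𝟘 y∈C
    where
    y∈C : (𝟙 ∷ inv a ⊗ b ∷ 0w [ j ]≔ (inv a ⊗ u)) ∈C G
    y∈C = subst (_∈C G) (cong₂ _∷_ (⊗-inverseˡ a a≢𝟘) (cong (inv a ⊗ b ∷_) (·w-[]≔ (inv a) j u)))
                (∈C-·w (inv a) x∈C)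
    leading𝟙 : ∀ {w : Word (suc k)} → 𝟙 ∷ w ≢ 0w
    leading𝟙 ()
    r≢𝟘 : inv a ⊗ b ≢ 𝟘
    r≢𝟘 r≡𝟘 = leading𝟙 (heavy _ (subst (λ r → (𝟙 ∷ r ∷ _) ∈C G) r≡𝟘 y∈C) (s≤s (wt-[]≔ j _)))
    u≢𝟘 : inv a ⊗ u ≢ 𝟘
    u≢𝟘 u≡𝟘 = leading𝟙 (heavy _ (subst (λ v → (𝟙 ∷ _ ∷ v) ∈C G) (trans (cong (0w [ j ]≔_) u≡𝟘) ([]≔𝟘 j)) y∈C)
                                (wt-∷∷0w 𝟙 (inv a ⊗ b)))

-- x_j comes from a nonzero codeword vanishing on the k − 1 coordinates 2 + l, l ≠ j.
systematicRows : (C : Code (2 + k) k) → Weight≥3 (gen C) → ∀ j → SystematicRow (gen C) j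
systematicRows {suc k} C heavy j =
  fromVanishing (vanishingCodeword C ≤-refl (λ l → suc (suc (punchIn j l))))
  where
  fromVanishing : (∃ λ x → x ∈C gen C × x ≢ 0w × ∀ l → lookup x (suc (suc (punchIn j l))) ≡ 𝟘) →
                  SystematicRow (gen C) j
  fromVanishing (a ∷ b ∷ v , x∈C , x≢0 , vanishes) =
    normalise heavy j (subst (λ w → (a ∷ b ∷ w) ∈C gen C) v≡ x∈C)
                      (x≢0 ∘ subst (λ w → a ∷ b ∷ w ≡ 0w) (sym v≡))
    where
    v≡ : v ≡ 0w [ j ]≔ lookup v j
    v≡ = ≡-[]≔-lookup v j vanishes

-- Injective on the nonzero elements; the value at 𝟘 is arbitrary.
index : F4 → Fin 3
index 𝟘  = zero
index 𝟙  = zero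
index ω  = suc zero
index ω² = suc (suc zero)

index-injective : ∀ x y → x ≢ 𝟘 → y ≢ 𝟘 → index x ≡ index y → x ≡ y
index-injective = from-yes (all? λ x → all? λ y →
  ¬? (x ≟ 𝟘) →-dec ¬? (y ≟ 𝟘) →-dec (index x Fin.≟ index y) →-dec (x ≟ y))

-- The Gram matrix of the rows 𝟙 ∷ r j ∷ u j eⱼ (herm-rows): the u j drop out since u ū = 𝟙,
-- and the last term is the Kronecker delta.
gram : Vec F4 k → Fin k → Fin k → F4
gram rs j l = 𝟙 ⊕ (lookup rs j ⊗ conj (lookup rs l) ⊕ lookup (0w [ j ]≔ 𝟙) l)

module _ {G : GenMat k (2 + k)} (heavy : Weight≥3 G) (rows : ∀ j → SystematicRow G j) where

  private module Row j = SystematicRow (rows j)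
  open Row

  row : Fin k → Word (2 + k)
  row j = 𝟙 ∷ r j ∷ 0w [ j ]≔ u j

  lookup-systematic : ∀ j → lookup (systematic r u) j ≡ row j
  lookup-systematic = lookup∘tabulate row

  systematic∈C : ∀ j → lookup (systematic r u) j ∈C G
  systematic∈C j = subst (_∈C G) (sym (lookup-systematic j)) (row∈C j)

  r-injective : ∀ {j l} → r j ≡ r l → j ≡ l
  r-injective {j} {l} rj≡rl with j Fin.≟ l
  ... | yes j≡l = j≡l
  ... | no j≢l  = ⊥-elim (u≢𝟘 j (begin
    u j                                         ≡⟨ ⊕-identityʳ (u j) ⟨
    u j ⊕ 𝟘                                     ≡⟨ cong₂ _⊕_ (lookup∘update j 0w (u j))
                                                              (trans (lookup∘update′ j≢l 0w (u l)) (lookup-0w j)) ⟨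
    lookup (0w [ j ]≔ u j) j ⊕ lookup (0w [ l ]≔ u l) j ≡⟨ lookup-+w (0w [ j ]≔ u j) (0w [ l ]≔ u l) j ⟨
    lookup ((0w [ j ]≔ u j) +w (0w [ l ]≔ u l)) j  ≡⟨ cong (λ w → lookup (tail (tail w)) j) sum≡0 ⟩
    lookup 0w j                                 ≡⟨ lookup-0w j ⟩
    𝟘                                           ∎))
    where
    sum∈C : (𝟘 ∷ 𝟘 ∷ ((0w [ j ]≔ u j) +w (0w [ l ]≔ u l))) ∈C G
    sum∈C = subst (λ b → (𝟘 ∷ b ∷ ((0w [ j ]≔ u j) +w (0w [ l ]≔ u l))) ∈C G)
                  (trans (cong (r j ⊕_) (sym rj≡rl)) (⊕-self (r j)))
                  (∈C-+w (row∈C j) (row∈C l))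
    sum≡0 : 𝟘 ∷ 𝟘 ∷ ((0w [ j ]≔ u j) +w (0w [ l ]≔ u l)) ≡ 0w
    sum≡0 = heavy _ sum∈C (≤-trans (wt-+w (0w [ j ]≔ u j) (0w [ l ]≔ u l))
                                   (+-mono-≤ (wt-[]≔ j (u j)) (wt-[]≔ l (u l))))

  spans : ∀ {y} → y ∈C G → ∃ λ μ → lincomb μ (systematic r u) ≡ y
  spans {a ∷ b ∷ v} y∈C =
    μ , tail-determines-codeword heavy (lincomb-∈C μ (systematic r u) systematic∈C) y∈C (begin
      tail (tail (lincomb μ (systematic r u)))  ≡⟨ cong (tail ∘ tail) (lincomb-systematic μ r u) ⟩
      tabulate (λ j → lookup μ j ⊗ u j)         ≡⟨ tabulate-cong coefficient ⟩
      tabulate (lookup v)                       ≡⟨ tabulate∘lookup v ⟩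
      v                                         ∎)
    where
    μ = tabulate λ j → lookup v j ⊗ inv (u j)
    coefficient : ∀ j → lookup μ j ⊗ u j ≡ lookup v j
    coefficient j = begin
      lookup μ j ⊗ u j              ≡⟨ cong (_⊗ u j) (lookup∘tabulate _ j) ⟩
      (lookup v j ⊗ inv (u j)) ⊗ u j ≡⟨ ⊗-assoc (lookup v j) (inv (u j)) (u j) ⟩
      lookup v j ⊗ (inv (u j) ⊗ u j) ≡⟨ cong (lookup v j ⊗_) (⊗-inverseˡ (u j) (u≢𝟘 j)) ⟩
      lookup v j ⊗ 𝟙                ≡⟨ ⊗-identityʳ (lookup v j) ⟩
      lookup v j                    ∎

  herm-rows : ∀ j l → herm (row j) (row l) ≡ gram (tabulate r) j l
  herm-rows j l = begin
    𝟙 ⊕ (r j ⊗ conj (r l) ⊕ herm (0w [ j ]≔ u j) (0w [ l ]≔ u l))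
      ≡⟨ cong (λ h → 𝟙 ⊕ (r j ⊗ conj (r l) ⊕ h)) (trans (herm-[]≔ʳ (0w [ j ]≔ u j) l (u l)) normalised) ⟩
    𝟙 ⊕ (r j ⊗ conj (r l) ⊕ lookup (0w [ j ]≔ 𝟙) l)
      ≡⟨ cong₂ (λ a b → 𝟙 ⊕ (a ⊗ conj b ⊕ lookup (0w [ j ]≔ 𝟙) l)) (lookup∘tabulate r j) (lookup∘tabulate r l) ⟨
    gram (tabulate r) j l ∎
    where
    normalised : lookup (0w [ j ]≔ u j) l ⊗ conj (u l) ≡ lookup (0w [ j ]≔ 𝟙) l
    normalised with j Fin.≟ l
    ... | yes refl = begin
      lookup (0w [ j ]≔ u j) j ⊗ conj (u j) ≡⟨ cong (_⊗ conj (u j)) (lookup∘update j 0w (u j)) ⟩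
      u j ⊗ conj (u j)                      ≡⟨ ⊗-conj-self (u j) (u≢𝟘 j) ⟩
      𝟙                                     ≡⟨ lookup∘update j 0w 𝟙 ⟨
      lookup (0w [ j ]≔ 𝟙) j                ∎
    ... | no j≢l   = begin
      lookup (0w [ j ]≔ u j) l ⊗ conj (u l) ≡⟨ cong (_⊗ conj (u l)) (off-diagonal (u j)) ⟩
      𝟘                                     ≡⟨ off-diagonal 𝟙 ⟨
      lookup (0w [ j ]≔ 𝟙) l                ∎
      where
      off-diagonal : ∀ v → lookup (0w [ j ]≔ v) l ≡ 𝟘
      off-diagonal v = trans (lookup∘update′ (j≢l ∘ sym) 0w v) (lookup-0w l)

  gram-singular⇒¬HermLCD : ∀ (ν : Vec F4 k) j₀ → lookup ν j₀ ≢ 𝟘 →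
    (∀ l → dot ν (tabulate λ j → gram (tabulate r) j l) ≡ 𝟘) → ¬ HermLCD G
  gram-singular⇒¬HermLCD ν j₀ νj₀≢𝟘 singular lcd =
    z≢0 (lcd z (lincomb-∈C ν (systematic r u) systematic∈C) z⊥C)
    where
    z = lincomb ν (systematic r u)
    z⊥rows : ∀ l → herm z (lookup (systematic r u) l) ≡ 𝟘
    z⊥rows l = begin
      herm z (lookup (systematic r u) l)                ≡⟨ cong (herm z) (lookup-systematic l) ⟩
      herm z (row l)                                    ≡⟨ herm-lincombˡ ν (systematic r u) (row l) ⟩
      dot ν (map (λ x → herm x (row l)) (tabulate row)) ≡⟨ cong (dot ν) (tabulate-∘ (λ x → herm x (row l)) row) ⟨
      dot ν (tabulate λ j → herm (row j) (row l))       ≡⟨ cong (dot ν) (tabulate-cong λ j → herm-rows j l) ⟩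
      dot ν (tabulate λ j → gram (tabulate r) j l)      ≡⟨ singular l ⟩
      𝟘                                                 ∎
    z⊥C : z ∈C⊥H G
    z⊥C y y∈C with μ , refl ← spans y∈C = herm-lincombʳ z μ (systematic r u) z⊥rows
    z≢0 : z ≢ 0w
    z≢0 z≡0 = ⊗-nonzero (lookup ν j₀) (u j₀) νj₀≢𝟘 (u≢𝟘 j₀) (begin
      lookup ν j₀ ⊗ u j₀                          ≡⟨ lookup∘tabulate (λ j → lookup ν j ⊗ u j) j₀ ⟨
      lookup (tabulate λ j → lookup ν j ⊗ u j) j₀ ≡⟨ cong (λ w → lookup (tail (tail w)) j₀) (lincomb-systematic ν r u) ⟨
      lookup (tail (tail z)) j₀                   ≡⟨ cong (λ w → lookup (tail (tail w)) j₀) z≡0 ⟩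
      lookup 0w j₀                                ≡⟨ lookup-0w j₀ ⟩
      𝟘                                           ∎)

  k≤3 : k ≤ 3
  k≤3 = injective⇒≤ {f = index ∘ r} λ {j} {l} e →
    r-injective (index-injective (r j) (r l) (r≢𝟘 j) (r≢𝟘 l) e)

-- For distinct nonzero a, b the determinant 1 + (1 + a/b)(1 + b/a) vanishes.
gram₂-singular : ∀ a b → a ≢ 𝟘 → b ≢ 𝟘 → a ≢ b →
  ∀ l → dot (𝟙 ∷ b ⊗ inv a ∷ []) (tabulate λ j → gram (a ∷ b ∷ []) j l) ≡ 𝟘
gram₂-singular = from-yes (all? λ a → all? λ b →
  ¬? (a ≟ 𝟘) →-dec ¬? (b ≟ 𝟘) →-dec ¬? (a ≟ b) →-dec
  Fin.all? λ l → dot (𝟙 ∷ b ⊗ inv a ∷ []) (tabulate λ j → gram (a ∷ b ∷ []) j l) ≟ 𝟘)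

-- Distinct nonzero a, b, c exhaust F4ˣ, so a + b + c = 𝟘 and each column sums to 1 + 1 = 𝟘.
gram₃-singular : ∀ a b c → a ≢ 𝟘 → b ≢ 𝟘 → c ≢ 𝟘 → a ≢ b → a ≢ c → b ≢ c →
  ∀ l → dot (𝟙 ∷ 𝟙 ∷ 𝟙 ∷ []) (tabulate λ j → gram (a ∷ b ∷ c ∷ []) j l) ≡ 𝟘
gram₃-singular = from-yes (all? λ a → all? λ b → all? λ c →
  ¬? (a ≟ 𝟘) →-dec ¬? (b ≟ 𝟘) →-dec ¬? (c ≟ 𝟘) →-dec ¬? (a ≟ b) →-dec ¬? (a ≟ c) →-dec ¬? (b ≟ c) →-dec
  Fin.all? λ l → dot (𝟙 ∷ 𝟙 ∷ 𝟙 ∷ []) (tabulate λ j → gram (a ∷ b ∷ c ∷ []) j l) ≟ 𝟘)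

module _ {G : GenMat 2 4} (heavy : Weight≥3 G) (rows : ∀ j → SystematicRow G j) where

  private module Row j = SystematicRow (rows j)
  open Row

  ¬HermLCD₂ : ¬ HermLCD G
  ¬HermLCD₂ = gram-singular⇒¬HermLCD heavy rows (𝟙 ∷ r (suc zero) ⊗ inv (r zero) ∷ []) zero (λ ())
    (gram₂-singular (r zero) (r (suc zero)) (r≢𝟘 zero) (r≢𝟘 (suc zero)) ((λ ()) ∘ r-injective heavy rows))

module _ {G : GenMat 3 5} (heavy : Weight≥3 G) (rows : ∀ j → SystematicRow G j) where

  private module Row j = SystematicRow (rows j)
  open Row

  ¬HermLCD₃ : ¬ HermLCD G
  ¬HermLCD₃ = gram-singular⇒¬HermLCD heavy rows (𝟙 ∷ 𝟙 ∷ 𝟙 ∷ []) zero (λ ())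
    (gram₃-singular (r zero) (r (suc zero)) (r (suc (suc zero)))
                    (r≢𝟘 zero) (r≢𝟘 (suc zero)) (r≢𝟘 (suc (suc zero)))
                    ((λ ()) ∘ r-injective heavy rows) ((λ ()) ∘ r-injective heavy rows)
                    ((λ ()) ∘ r-injective heavy rows))

¬HermLCD : (C : Code (4 + m) (2 + m)) → Weight≥3 (gen C) → ¬ HermLCD (gen C)
¬HermLCD {zero}        C heavy = ¬HermLCD₂ heavy (systematicRows C heavy)
¬HermLCD {suc zero}    C heavy = ¬HermLCD₃ heavy (systematicRows C heavy)
¬HermLCD {suc (suc m)} C heavy _ = <⇒≱ (m≤m+n 4 m) (k≤3 heavy (systematicRows C heavy))

minWeight≤2 : ∀ {d} (C : Code (4 + m) (2 + m)) → HermLCD (gen C) → HasMinWeight (gen C) d → d ≤ 2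
minWeight≤2 {d = d} C lcd hasMin with d ≤? 2
... | yes d≤2 = d≤2
... | no d≰2  = ⊥-elim (¬HermLCD C (HasMinWeight⇒Weight≥3 hasMin (≰⇒> d≰2)) lcd)

-- The LCD codes attaining the bound

lcdGenerator : GenMat k (2 + k)
lcdGenerator = systematic (λ _ → ω) (λ _ → 𝟙)

lincomb-lcdGenerator : ∀ (c : Vec F4 k) → lincomb c lcdGenerator ≡ sum c ∷ ω ⊗ sum c ∷ c
lincomb-lcdGenerator c = begin
  lincomb c lcdGenerator
    ≡⟨ lincomb-systematic c (λ _ → ω) (λ _ → 𝟙) ⟩
  sum c ∷ dot c (tabulate λ _ → ω) ∷ tabulate (λ j → lookup c j ⊗ 𝟙)
    ≡⟨ cong₂ (λ a w → sum c ∷ a ∷ w) (dot-const c ω)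
             (trans (tabulate-cong (⊗-identityʳ ∘ lookup c)) (tabulate∘lookup c)) ⟩
  sum c ∷ ω ⊗ sum c ∷ c ∎

lcdCode : ∀ k → Code (2 + k) k
lcdCode k = code lcdGenerator λ c lincomb≡0w → begin
  c                                    ≡⟨ cong (tail ∘ tail) (lincomb-lcdGenerator c) ⟨
  tail (tail (lincomb c lcdGenerator)) ≡⟨ cong (tail ∘ tail) lincomb≡0w ⟩
  0w                                   ∎

-- ω ω̄ = 𝟙, so the coordinates (s, ω s) contribute nothing to the form.
ω-pair-isotropic : ∀ s t h → s ⊗ conj t ⊕ ((ω ⊗ s) ⊗ conj (ω ⊗ t) ⊕ h) ≡ h
ω-pair-isotropic = from-yes (all? λ s → all? λ t → all? λ h →
  s ⊗ conj t ⊕ ((ω ⊗ s) ⊗ conj (ω ⊗ t) ⊕ h) ≟ h)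

lcdCode-HermLCD : ∀ k → HermLCD (gen (lcdCode k))
lcdCode-HermLCD k _ (c , refl) x⊥C =
  trans (cong (λ c → lincomb c lcdGenerator) c≡0) (lincomb-0w lcdGenerator)
  where
  c≡0 : c ≡ 0w
  c≡0 = herm-nondegenerate c λ c′ → begin
    herm c c′
      ≡⟨ ω-pair-isotropic (sum c) (sum c′) (herm c c′) ⟨
    herm (sum c ∷ ω ⊗ sum c ∷ c) (sum c′ ∷ ω ⊗ sum c′ ∷ c′)
      ≡⟨ cong₂ herm (lincomb-lcdGenerator c) (lincomb-lcdGenerator c′) ⟨
    herm (lincomb c lcdGenerator) (lincomb c′ lcdGenerator)
      ≡⟨ x⊥C _ (c′ , refl) ⟩
    𝟘 ∎

2≤wt-encoded : ∀ (c : Vec F4 k) → c ≢ 0w → 2 ≤ wt (sum c ∷ ω ⊗ sum c ∷ c)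
2≤wt-encoded c c≢0 with sum c ≟ 𝟘
... | yes s≡𝟘 = subst (λ s → 2 ≤ wt (s ∷ ω ⊗ s ∷ c)) (sym s≡𝟘) (sum≡𝟘⇒2≤wt c c≢0 s≡𝟘)
... | no s≢𝟘  = subst (2 ≤_) (sym (wt-∷-nonzero (ω ⊗ sum c ∷ c) s≢𝟘))
                      (s≤s (≤-trans (≢0w⇒1≤wt c c≢0) (wt-≤∷ (ω ⊗ sum c) c)))

lcdCode-minWeight : ∀ m → HasMinWeight (gen (lcdCode (2 + m))) 2
lcdCode-minWeight m = (x , (c , refl) , x≢0 , wt-x) , atLeast2
  where
  c : Vec F4 (2 + m)
  c = 𝟙 ∷ 𝟙 ∷ 0w
  x = lincomb c lcdGenerator
  x≡ : x ≡ 𝟘 ∷ 𝟘 ∷ c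
  x≡ = trans (lincomb-lcdGenerator c) (cong (λ s → s ∷ ω ⊗ s ∷ c) (cong (λ t → 𝟙 ⊕ (𝟙 ⊕ t)) (sum-0w m)))
  x≢0 : x ≢ 0w
  x≢0 x≡0 with () ← cong (head ∘ tail ∘ tail) (trans (sym x≡) x≡0)
  wt-x : wt x ≡ 2
  wt-x = trans (cong wt x≡) (cong (2 +_) (wt-0w m))
  atLeast2 : ∀ y → y ∈C lcdGenerator → y ≢ 0w → 2 ≤ wt y
  atLeast2 _ (c′ , refl) y≢0 =
    subst (λ w → 2 ≤ wt w) (sym (lincomb-lcdGenerator c′)) (2≤wt-encoded c′ (lincomb≢0w⇒≢0w y≢0))

lcdCode₁-minWeight : HasMinWeight (gen (lcdCode 1)) 3
lcdCode₁-minWeight = (lincomb (𝟙 ∷ []) lcdGenerator , (𝟙 ∷ [] , refl) , (λ ()) , refl) , atLeast3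
  where
  atLeast3 : ∀ y → y ∈C lcdGenerator → y ≢ 0w → 3 ≤ wt y
  atLeast3 _ (𝟘  ∷ [] , refl) y≢0 = ⊥-elim (y≢0 refl)
  atLeast3 _ (𝟙  ∷ [] , refl) _   = ≤-refl
  atLeast3 _ (ω  ∷ [] , refl) _   = ≤-refl
  atLeast3 _ (ω² ∷ [] , refl) _   = ≤-refl

proposition3p3 : IsD4 3 (3 ∸ 2) 3 × (∀ (n : ℕ) → 4 ≤ n → IsD4 n (n ∸ 2) 2)
proposition3p3 =
  ((lcdCode 1 , lcdCode-HermLCD 1 , lcdCode₁-minWeight) , λ _ _ _ → minWeight≤length) ,
  λ { (suc (suc (suc (suc m)))) (s≤s (s≤s (s≤s (s≤s _)))) →
        (lcdCode (2 + m) , lcdCode-HermLCD (2 + m) , lcdCode-minWeight m) ,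
        λ C lcd _ → minWeight≤2 C lcd }
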